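{- For every graph $G$ without isolated edges, $\overline{\chi^t_{\Sigma}}(G)\leq\overline{\chi^e_{\Sigma}}(G)$.
   Context: All graphs are finite, simple and undirected; $G$ has no isolated edges means no connected component of $G$ is isomorphic to $K_2$. An edge $k$-colouring of $G$ is any map $\gamma:E(G)\to\{1,\dots,k\}$, inducing $\sigma_\gamma(v)=\sum_{e\ni v}\gamma(e)$; a total $k$-colouring is any map $\gamma_t:V(G)\cup E(G)\to\{1,\dots,k\}$, inducing $\sigma^T(v)=\gamma_t(v)+\sum_{e\ni v}\gamma_t(e)$ (colourings need not be proper). Such a colouring is neighbour-sum-distinguishing if the induced sums differ at the two ends of every edge, and equitable if for any two colours the numbers of coloured elements (edges, resp. vertices and edges) with those colours differ by at most one. $\overline{\chi^e_{\Sigma}}(G)$ (resp. $\overline{\chi^t_{\Sigma}}(G)$) is the smallest $k$ such that $G$ admits an equitable neighbour-sum-distinguishing edge (resp. total) $k$-colouring. -}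

module Defs where

open import Data.Nat using (ℕ; zero; suc; _+_; _≤_; _<_)
open import Data.Fin using (Fin; toℕ)
open import Data.Fin.Properties using (_≟_)
open import Data.List using (List; map; filter; length; allFin)
open import Data.Nat.ListAction using (sum)
open import Data.Product using (Σ; _×_; _,_; proj₁; proj₂; ∃)
open import Data.Sum using (_⊎_)
open import Relation.Nullary using (¬_; Dec; yes; no)
open import Relation.Nullary.Decidable using (_⊎-dec_)
open import Relation.Binary.PropositionalEquality using (_≡_; _≢_)

-- Each edge is an unordered pair {u,v} with u ≠ v, stored in the normal
-- form (u , v) with toℕ u < toℕ v; distinct edge indices give distinct
-- pairs (no multi-edges).
record Graph : Set where
  field
    n     : ℕ
    m     : ℕ
    ends  : Fin m → Fin n × Fin n
    lt    : ∀ e → toℕ (proj₁ (ends e)) < toℕ (proj₂ (ends e))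
    inj   : ∀ e f → ends e ≡ ends f → e ≡ f

module _ (G : Graph) where
  open Graph G

  incident? : (v : Fin n) (e : Fin m) → Dec ((proj₁ (ends e) ≡ v) ⊎ (proj₂ (ends e) ≡ v))
  incident? v e = (proj₁ (ends e) ≟ v) ⊎-dec (proj₂ (ends e) ≟ v)

  incEdges : Fin n → List (Fin m)
  incEdges v = filter (incident? v) (allFin m)

  degree : Fin n → ℕ
  degree v = length (incEdges v)

  -- G has no isolated edges: no connected component is K₂, i.e. there is
  -- no edge both of whose endpoints have degree 1.
  NoIsolatedEdges : Set
  NoIsolatedEdges = ∀ e → ¬ (degree (proj₁ (ends e)) ≡ 1 × degree (proj₂ (ends e)) ≡ 1)

  -- colours: Fin k represents {1,…,k}, colour c has value toℕ c + 1
  val : ∀ {k} → Fin k → ℕ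
  val c = suc (toℕ c)

  σ : ∀ {k} → (Fin m → Fin k) → Fin n → ℕ
  σ γ v = sum (map (λ e → val (γ e)) (incEdges v))

  σT : ∀ {k} → (Fin n → Fin k) → (Fin m → Fin k) → Fin n → ℕ
  σT γv γe v = val (γv v) + σ γe v

  countE : ∀ {k} → (Fin m → Fin k) → Fin k → ℕ
  countE γ c = length (filter (λ e → γ e ≟ c) (allFin m))

  countV : ∀ {k} → (Fin n → Fin k) → Fin k → ℕ
  countV γ c = length (filter (λ v → γ v ≟ c) (allFin n))

  NSDEdge : ∀ {k} → (Fin m → Fin k) → Set
  NSDEdge γ = ∀ e → σ γ (proj₁ (ends e)) ≢ σ γ (proj₂ (ends e))

  NSDTotal : ∀ {k} → (Fin n → Fin k) → (Fin m → Fin k) → Set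
  NSDTotal γv γe = ∀ e → σT γv γe (proj₁ (ends e)) ≢ σT γv γe (proj₂ (ends e))

  EquitableEdge : ∀ {k} → (Fin m → Fin k) → Set
  EquitableEdge γ = ∀ c c' → countE γ c ≤ suc (countE γ c')

  EquitableTotal : ∀ {k} → (Fin n → Fin k) → (Fin m → Fin k) → Set
  EquitableTotal γv γe =
    ∀ c c' → countV γv c + countE γe c ≤ suc (countV γv c' + countE γe c')

  HasEqNSDEdge : ℕ → Set
  HasEqNSDEdge k = Σ (Fin m → Fin k) λ γ → EquitableEdge γ × NSDEdge γ

  HasEqNSDTotal : ℕ → Set
  HasEqNSDTotal k =
    Σ (Fin n → Fin k) λ γv → Σ (Fin m → Fin k) λ γe →
      EquitableTotal γv γe × NSDTotal γv γe

module Submission where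

-- Let γ be an equitable NSD edge k-colouring with edge sums σ.  We keep
-- γ on the edges and colour the vertices MONOTONICALLY in σ: if σ u < σ v then
-- the vertex colour of u is at most that of v.  Then σT = vertex colour + σ
-- is still strictly smaller at u than at v, so every edge stays distinguished.  Equitability is
-- obtained by choosing how many vertices get each colour: greedily adding n
-- elements, one at a time, to a currently smallest total class keeps the
-- class sizes within one of each other.

open import Defs
open import Data.Nat using (ℕ; _≤_)
open import Data.Product using (Σ; _×_)
open import Level using (0ℓ)
open import Data.Nat using (zero; suc; _+_; _*_; _<_; _⊔_; _<ᵇ_; z≤n; s≤s; s≤s⁻¹; _≤?_)
open import Data.Nat.Properties hiding (_≟_; suc-injective)
open import Algebra.Properties.CommutativeSemigroup +-commutativeSemigroup using (interchange)
open import Data.Bool using (Bool; true; false; T; _∧_; not; if_then_else_)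
open import Data.Bool.Properties using (∧-comm; ∧-identityʳ; ∧-zeroʳ)
open import Data.Unit using (tt)
open import Data.Fin using (Fin; toℕ) renaming (zero to fz; suc to fs)
open import Data.Fin.Properties using (_≟_; toℕ<n; toℕ-injective; suc-injective)
open import Data.List using (filter; length; tabulate)
open import Data.Vec using (Vec; []; _∷_; lookup; sum; replicate; updateAt)
open import Data.Vec.Properties using (lookup∘updateAt; lookup∘updateAt′; lookup-replicate)
open import Data.Product using (_,_; proj₁; proj₂; ∃)
open import Relation.Nullary using (yes; no; does)
open import Relation.Unary using (Pred; Decidable)
open import Relation.Binary.PropositionalEquality
open import Relation.Binary using (tri<; tri≈; tri>)
open import Data.Empty using (⊥-elim)
open import Function using (_∘_)

<⇒<ᵇ≡true : ∀ {a b} → a < b → (a <ᵇ b) ≡ true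
<⇒<ᵇ≡true {a} {b} a<b with a <ᵇ b | <⇒<ᵇ a<b
... | true | _ = refl

<ᵇ≡true⇒< : ∀ a b → (a <ᵇ b) ≡ true → a < b
<ᵇ≡true⇒< a b e = <ᵇ⇒< a b (subst T (sym e) tt)

≥⇒<ᵇ≡false : ∀ {a b} → b ≤ a → (a <ᵇ b) ≡ false
≥⇒<ᵇ≡false {a} {b} b≤a with a <ᵇ b in e
... | false = refl
... | true  = ⊥-elim (≤⇒≯ b≤a (<ᵇ≡true⇒< a b e))

<ᵇ≡false⇒≥ : ∀ a b → (a <ᵇ b) ≡ false → b ≤ a
<ᵇ≡false⇒≥ a b e = ≮⇒≥ (λ a<b → subst T e (<⇒<ᵇ a<b))

-- Counting the elements of Fin n satisfying a Boolean predicate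

bit : Bool → ℕ
bit true  = 1
bit false = 0

count : ∀ n → (Fin n → Bool) → ℕ
count zero    p = 0
count (suc n) p = bit (p fz) + count n (p ∘ fs)

length-filter-tabulate : ∀ {A : Set} {P : Pred A 0ℓ} (P? : Decidable P) n (f : Fin n → A) →
  length (filter P? (tabulate f)) ≡ count n (λ i → does (P? (f i)))
length-filter-tabulate P? zero    f = refl
length-filter-tabulate P? (suc n) f with does (P? (f fz))
... | true  = cong suc (length-filter-tabulate P? n (f ∘ fs))
... | false = length-filter-tabulate P? n (f ∘ fs)

count-cong : ∀ n {p q : Fin n → Bool} → (∀ i → p i ≡ q i) → count n p ≡ count n q
count-cong zero    p≗q = refl
count-cong (suc n) p≗q = cong₂ _+_ (cong bit (p≗q fz)) (count-cong n (p≗q ∘ fs))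

count-split : ∀ n (p q : Fin n → Bool) →
  count n p ≡ count n (λ i → p i ∧ q i) + count n (λ i → p i ∧ not (q i))
count-split zero    p q = refl
count-split (suc n) p q = begin
  bit (p fz) + count n (p ∘ fs)
    ≡⟨ cong₂ _+_ (bit-split (p fz) (q fz)) (count-split n (p ∘ fs) (q ∘ fs)) ⟩
  (bit (p fz ∧ q fz) + bit (p fz ∧ not (q fz))) + (count n p∧q + count n p∧¬q)
    ≡⟨ interchange (bit (p fz ∧ q fz)) _ (count n p∧q) _ ⟩
  (bit (p fz ∧ q fz) + count n p∧q) + (bit (p fz ∧ not (q fz)) + count n p∧¬q) ∎
  where
  open ≡-Reasoning
  p∧q p∧¬q : Fin n → Bool
  p∧q  i = p (fs i) ∧ q (fs i)
  p∧¬q i = p (fs i) ∧ not (q (fs i))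

  bit-split : ∀ a b → bit a ≡ bit (a ∧ b) + bit (a ∧ not b)
  bit-split true  true  = refl
  bit-split true  false = refl
  bit-split false b     = refl

count-mono : ∀ n {p q : Fin n → Bool} → (∀ i → p i ≡ true → q i ≡ true) → count n p ≤ count n q
count-mono zero    p⇒q = z≤n
count-mono (suc n) {p} {q} p⇒q = +-mono-≤ (bit-mono (p fz) (q fz) (p⇒q fz)) (count-mono n (p⇒q ∘ fs))
  where
  bit-mono : ∀ a b → (a ≡ true → b ≡ true) → bit a ≤ bit b
  bit-mono true  b a⇒b rewrite a⇒b refl = ≤-refl
  bit-mono false b a⇒b = z≤n

count≤n : ∀ n p → count n p ≤ n
count≤n zero    p = z≤n
count≤n (suc n) p with p fz
... | true  = s≤s (count≤n n (p ∘ fs))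
... | false = m≤n⇒m≤1+n (count≤n n (p ∘ fs))

count-all : ∀ n p → (∀ i → p i ≡ true) → count n p ≡ n
count-all zero    p all = refl
count-all (suc n) p all rewrite all fz = cong suc (count-all n (p ∘ fs) (all ∘ fs))

count-none : ∀ n p → (∀ i → p i ≡ false) → count n p ≡ 0
count-none zero    p none = refl
count-none (suc n) p none rewrite none fz = count-none n (p ∘ fs) (none ∘ fs)

count-witness : ∀ n p i → p i ≡ true → 1 ≤ count n p
count-witness (suc n) p fz     pi rewrite pi = s≤s z≤n
count-witness (suc n) p (fs i) pi = ≤-trans (count-witness n (p ∘ fs) i pi) (m≤n+m _ (bit (p fz)))

count-unique : ∀ n p → (∀ i j → p i ≡ true → p j ≡ true → i ≡ j) → count n p ≤ 1
count-unique zero    p unique = z≤n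
count-unique (suc n) p unique with p fz in p0
... | true  = ≤-reflexive (cong suc (count-none n (p ∘ fs) only-zero))
  where
  only-zero : ∀ i → p (fs i) ≡ false
  only-zero i with p (fs i) in pi
  ... | false = refl
  ... | true  with () ← unique fz (fs i) p0 pi
... | false = count-unique n (p ∘ fs) λ i j pi pj → suc-injective (unique (fs i) (fs j) pi pj)

maximum : ∀ n → (Fin n → ℕ) → ℕ
maximum zero    f = 0
maximum (suc n) f = f fz ⊔ maximum n (f ∘ fs)

≤-maximum : ∀ n f (i : Fin n) → f i ≤ maximum n f
≤-maximum (suc n) f fz     = m≤m⊔n _ _
≤-maximum (suc n) f (fs i) = ≤-trans (≤-maximum n (f ∘ fs) i) (m≤n⊔m (f fz) _)

hits-every-value : (f : ℕ → ℕ) → f 0 ≡ 0 → (∀ t → f (suc t) ≤ suc (f t)) →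
  ∀ K b → b ≤ f K → ∃ λ t → f t ≡ b
hits-every-value f f0 step zero    b b≤f0 = 0 , trans f0 (sym (n≤0⇒n≡0 (≤-trans b≤f0 (≤-reflexive f0))))
hits-every-value f f0 step (suc K) b b≤fK with b ≤? f K
... | yes b≤ = hits-every-value f f0 step K b b≤
... | no  b≰ = suc K , ≤-antisym (≤-trans (step K) (≰⇒> b≰)) b≤fK

-- Ranking the elements of Fin n by an injective key.

module Ranking {n : ℕ} (key : Fin n → ℕ) (key-injective : ∀ u v → key u ≡ key v → u ≡ v) where

  below : ℕ → ℕ
  below t = count n (λ w → key w <ᵇ t)

  rank : Fin n → ℕ
  rank v = below (key v)

  below-mono : ∀ {t t'} → t ≤ t' → below t ≤ below t'
  below-mono {t} t≤t' = count-mono n λ w lt → <⇒<ᵇ≡true (<-≤-trans (<ᵇ≡true⇒< (key w) t lt) t≤t')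

  below-zero : below 0 ≡ 0
  below-zero = count-none n _ λ w → refl

  at : ℕ → Fin n → Bool
  at t w = (key w <ᵇ suc t) ∧ not (key w <ᵇ t)

  at⇒key : ∀ t w → at t w ≡ true → key w ≡ t
  at⇒key t w e with key w <ᵇ suc t in lt | key w <ᵇ t in ge
  at⇒key t w e  | true  | false = ≤-antisym (s≤s⁻¹ (<ᵇ≡true⇒< (key w) (suc t) lt)) (<ᵇ≡false⇒≥ (key w) t ge)

  at-key : ∀ w → at (key w) w ≡ true
  at-key w rewrite <⇒<ᵇ≡true (n<1+n (key w)) | ≥⇒<ᵇ≡false (≤-refl {key w}) = refl

  below-suc : ∀ t → below (suc t) ≡ below t + count n (at t)
  below-suc t = trans (count-split n _ (λ w → key w <ᵇ t))
                      (cong (_+ count n (at t)) (count-cong n already-below))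
    where
    already-below : ∀ w → ((key w <ᵇ suc t) ∧ (key w <ᵇ t)) ≡ (key w <ᵇ t)
    already-below w with key w <ᵇ t in lt
    ... | true  = trans (∧-identityʳ _) (<⇒<ᵇ≡true (m<n⇒m<1+n (<ᵇ≡true⇒< (key w) t lt)))
    ... | false = ∧-zeroʳ _

  -- since the key is injective, at most one element has key t
  below-step : ∀ t → below (suc t) ≤ suc (below t)
  below-step t = begin
    below (suc t)            ≡⟨ below-suc t ⟩
    below t + count n (at t) ≤⟨ +-monoʳ-≤ (below t) at-most-one ⟩
    below t + 1              ≡⟨ +-comm (below t) 1 ⟩
    suc (below t)            ∎
    where
    open ≤-Reasoning
    at-most-one : count n (at t) ≤ 1
    at-most-one = count-unique n (at t) λ i j ai aj →
      key-injective i j (trans (at⇒key t i ai) (sym (at⇒key t j aj)))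

  -- v is counted in below (suc (key v)) but not in its own rank
  rank<below : ∀ v → rank v < below (suc (key v))
  rank<below v = begin-strict
    rank v                              <⟨ n<1+n (rank v) ⟩
    suc (rank v)                        ≡⟨ +-comm 1 (rank v) ⟩
    rank v + 1                          ≤⟨ +-monoʳ-≤ (rank v) (count-witness n (at (key v)) v (at-key v)) ⟩
    rank v + count n (at (key v))       ≡⟨ below-suc (key v) ⟨
    below (suc (key v))                 ∎
    where open ≤-Reasoning

  rank<n : ∀ v → rank v < n
  rank<n v = <-≤-trans (rank<below v) (count≤n n _)

  rank-mono : ∀ u v → key u ≤ key v → rank u ≤ rank v
  rank-mono u v = below-mono

  -- choose a threshold t with below t = b (intermediate value theorem);
  -- the ranks below b then belong exactly to the keys below t
  rank-prefix : ∀ b → b ≤ n → count n (λ v → rank v <ᵇ b) ≡ b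
  rank-prefix b b≤n with hits-every-value below below-zero below-step (suc (maximum n key)) b
                           (≤-trans b≤n (≤-reflexive (sym below-everything)))
    where
    below-everything : below (suc (maximum n key)) ≡ n
    below-everything = count-all n _ λ w → <⇒<ᵇ≡true (s≤s (≤-maximum n key w))
  ... | t , below-t≡b = trans (count-cong n rank<b⇔key<t) below-t≡b
    where
    rank<b⇔key<t : ∀ v → (rank v <ᵇ b) ≡ (key v <ᵇ t)
    rank<b⇔key<t v with key v <ᵇ t in lt
    ... | true  = <⇒<ᵇ≡true (<-≤-trans (rank<below v)
                    (≤-trans (below-mono (<ᵇ≡true⇒< (key v) t lt)) (≤-reflexive below-t≡b)))
    ... | false = ≥⇒<ᵇ≡false (≤-trans (≤-reflexive (sym below-t≡b)) (below-mono (<ᵇ≡false⇒≥ (key v) t lt)))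

-- Block colourings.
-- block s (a₀ ∷ … ∷ aⱼ) x is the least c with x < s + a₀ + … + a_c (the last
-- block absorbs everything beyond): consecutive blocks of sizes a₀,…,aⱼ
-- starting at s.

block : ∀ {j} → ℕ → Vec ℕ (suc j) → ℕ → Fin (suc j)
block s (a ∷ [])     x = fz
block s (a ∷ b ∷ as) x = if x <ᵇ s + a then fz else fs (block (s + a) (b ∷ as) x)

block-mono : ∀ {j} s (as : Vec ℕ (suc j)) {x y} → x ≤ y → toℕ (block s as x) ≤ toℕ (block s as y)
block-mono s (a ∷ [])     x≤y = z≤n
block-mono s (a ∷ b ∷ as) {x} {y} x≤y with x <ᵇ s + a in ex | y <ᵇ s + a in ey
... | true  | _     = z≤n
... | false | true  = ⊥-elim (≤⇒≯ (<ᵇ≡false⇒≥ x (s + a) ex) (≤-<-trans x≤y (<ᵇ≡true⇒< y (s + a) ey)))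
... | false | false = s≤s (block-mono (s + a) (b ∷ as) x≤y)

block-first : ∀ {j} s a b (as : Vec ℕ j) x →
  does (block s (a ∷ b ∷ as) x ≟ fz) ≡ (x <ᵇ s + a)
block-first s a b as x with x <ᵇ s + a
... | true  = refl
... | false = refl

block-later : ∀ {j} s a b (as : Vec ℕ j) x c →
  (not (x <ᵇ s) ∧ does (block s (a ∷ b ∷ as) x ≟ fs c)) ≡
  (not (x <ᵇ s + a) ∧ does (block (s + a) (b ∷ as) x ≟ c))
block-later s a b as x c with x <ᵇ s + a in lt
... | true  = ∧-zeroʳ _
... | false rewrite ≥⇒<ᵇ≡false (≤-trans (m≤m+n s a) (<ᵇ≡false⇒≥ x (s + a) lt)) = refl

module Blocks {n : ℕ} (r : Fin n → ℕ) (r<n : ∀ v → r v < n)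
  (prefix : ∀ b → b ≤ n → count n (λ v → r v <ᵇ b) ≡ b) where

  interval : ∀ a b → a ≤ b → b ≤ n → a + count n (λ v → not (r v <ᵇ a) ∧ (r v <ᵇ b)) ≡ b
  interval a b a≤b b≤n = begin
    a + count n (λ v → not (r v <ᵇ a) ∧ (r v <ᵇ b))
      ≡⟨ cong₂ _+_ (sym (prefix a (≤-trans a≤b b≤n))) (count-cong n (λ v → ∧-comm (not (r v <ᵇ a)) (r v <ᵇ b))) ⟩
    count n (λ v → r v <ᵇ a) + count n (λ v → (r v <ᵇ b) ∧ not (r v <ᵇ a))
      ≡⟨ cong (_+ count n (λ v → (r v <ᵇ b) ∧ not (r v <ᵇ a))) (count-cong n below-a) ⟨
    count n (λ v → (r v <ᵇ b) ∧ (r v <ᵇ a)) + count n (λ v → (r v <ᵇ b) ∧ not (r v <ᵇ a))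
      ≡⟨ count-split n _ _ ⟨
    count n (λ v → r v <ᵇ b)
      ≡⟨ prefix b b≤n ⟩
    b ∎
    where
    open ≡-Reasoning
    below-a : ∀ v → ((r v <ᵇ b) ∧ (r v <ᵇ a)) ≡ (r v <ᵇ a)
    below-a v with r v <ᵇ a in lt
    ... | true  = trans (∧-identityʳ _) (<⇒<ᵇ≡true (<-≤-trans (<ᵇ≡true⇒< (r v) a lt) a≤b))
    ... | false = ∧-zeroʳ _

  block-count : ∀ {j} (as : Vec ℕ (suc j)) s → s + sum as ≡ n → ∀ c →
    count n (λ v → not (r v <ᵇ s) ∧ does (block s as (r v) ≟ c)) ≡ lookup as c
  block-count (a ∷ []) s s+a≡n fz = +-cancelˡ-≡ s _ _ (begin
    s + count n (λ v → not (r v <ᵇ s) ∧ true)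
      ≡⟨ cong (s +_) (count-cong n λ v → cong (not (r v <ᵇ s) ∧_) (sym (<⇒<ᵇ≡true (r<n v)))) ⟩
    s + count n (λ v → not (r v <ᵇ s) ∧ (r v <ᵇ n))
      ≡⟨ interval s n (≤-trans (m≤m+n s _) (≤-reflexive s+a≡n)) ≤-refl ⟩
    n ≡⟨ sym s+a≡n ⟩
    s + (a + 0) ≡⟨ cong (s +_) (+-identityʳ a) ⟩
    s + a ∎)
    where open ≡-Reasoning
  block-count (a ∷ b ∷ as) s s+Σ≡n fz = +-cancelˡ-≡ s _ _
    (trans (cong (s +_) (count-cong n λ v → cong (not (r v <ᵇ s) ∧_) (block-first s a b as (r v))))
           (interval s (s + a) (m≤m+n s a) s+a≤n))
    where
    s+a≤n : s + a ≤ n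
    s+a≤n = ≤-trans (m≤m+n (s + a) (sum (b ∷ as))) (≤-reflexive (trans (+-assoc s a _) s+Σ≡n))
  block-count (a ∷ b ∷ as) s s+Σ≡n (fs c) =
    trans (count-cong n λ v → block-later s a b as (r v) c)
          (block-count (b ∷ as) (s + a) (trans (+-assoc s a _) s+Σ≡n) c)

-- Equitable distributions and greedy filling

-- class sizes differing pairwise by at most one; EquitableEdge G γ is
-- literally Equitable (countE G γ)
Equitable : ∀ {k} → (Fin k → ℕ) → Set
Equitable f = ∀ c c' → f c ≤ suc (f c')

argmin : ∀ j (y : Fin (suc j) → ℕ) → ∃ λ i → ∀ c → y i ≤ y c
argmin zero    y = fz , λ { fz → ≤-refl }
argmin (suc j) y with argmin j (y ∘ fs)
... | i , min with y fz ≤? y (fs i)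
... | yes y0≤ = fz , λ { fz → ≤-refl ; (fs c) → ≤-trans y0≤ (min c) }
... | no  y0≰ = fs i , λ { fz → <⇒≤ (≰⇒> y0≰) ; (fs c) → min c }

-- Starting from equitable class sizes e, any number t of further elements can
-- be added (as c receives lookup as c of them) keeping the sizes equitable:
-- always add to a smallest class.
module Filling {k₀ : ℕ} (e : Fin (suc k₀) → ℕ) (e-equitable : Equitable e) where

  total : Vec ℕ (suc k₀) → Fin (suc k₀) → ℕ
  total as c = e c + lookup as c

  fill-step : ∀ as → Equitable (total as) →
    Σ (Vec ℕ (suc k₀)) λ as' → sum as' ≡ suc (sum as) × Equitable (total as')
  fill-step as equitable with argmin k₀ (total as)
  ... | i , min = updateAt as i suc , sum-updateAt as i , equitable'
    where
    sum-updateAt : ∀ {j} (xs : Vec ℕ j) i → sum (updateAt xs i suc) ≡ suc (sum xs)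
    sum-updateAt (x ∷ xs) fz     = refl
    sum-updateAt (x ∷ xs) (fs i) = trans (cong (x +_) (sum-updateAt xs i)) (+-suc x _)

    at-i : total (updateAt as i suc) i ≡ suc (total as i)
    at-i = trans (cong (e i +_) (lookup∘updateAt i as)) (+-suc (e i) _)

    elsewhere : ∀ c → c ≢ i → total (updateAt as i suc) c ≡ total as c
    elsewhere c c≢i = cong (e c +_) (lookup∘updateAt′ c i c≢i as)

    equitable' : Equitable (total (updateAt as i suc))
    equitable' c c' with c ≟ i | c' ≟ i
    ... | yes refl | yes refl = n≤1+n _
    ... | yes refl | no c'≢i rewrite at-i | elsewhere c' c'≢i = s≤s (min c')
    ... | no c≢i   | yes refl rewrite at-i | elsewhere c c≢i = m≤n⇒m≤1+n (equitable c i)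
    ... | no c≢i   | no c'≢i rewrite elsewhere c c≢i | elsewhere c' c'≢i = equitable c c'

  fill : ∀ t → Σ (Vec ℕ (suc k₀)) λ as → sum as ≡ t × Equitable (total as)
  fill zero = replicate _ 0 , sum-zeros (suc k₀) , equitable-zeros
    where
    sum-zeros : ∀ j → sum (replicate j 0) ≡ 0
    sum-zeros zero    = refl
    sum-zeros (suc j) = sum-zeros j

    total-zeros : ∀ c → total (replicate _ 0) c ≡ e c
    total-zeros c = trans (cong (e c +_) (lookup-replicate c 0)) (+-identityʳ (e c))

    equitable-zeros : Equitable (total (replicate _ 0))
    equitable-zeros c c' rewrite total-zeros c | total-zeros c' = e-equitable c c'
  fill (suc t) with fill t
  ... | as , refl , equitable = fill-step as equitable

-- From an equitable NSD edge colouring to an equitable NSD total colouring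

module FromEdgeColouring (G : Graph) {k₀ : ℕ} (γ : Fin (Graph.m G) → Fin (suc k₀))
  (γ-equitable : EquitableEdge G γ) (γ-nsd : NSDEdge G γ) where
  open Graph G

  -- injective refinement of the edge sums, breaking ties by vertex index
  key : Fin n → ℕ
  key v = σ G γ v * n + toℕ v

  key-strict : ∀ u v → σ G γ u < σ G γ v → key u < key v
  key-strict u v σu<σv = begin-strict
    σ G γ u * n + toℕ u <⟨ +-monoʳ-< (σ G γ u * n) (toℕ<n u) ⟩
    σ G γ u * n + n     ≡⟨ +-comm (σ G γ u * n) n ⟩
    suc (σ G γ u) * n   ≤⟨ *-monoˡ-≤ n σu<σv ⟩
    σ G γ v * n         ≤⟨ m≤m+n _ (toℕ v) ⟩
    key v               ∎
    where open ≤-Reasoning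

  key-injective : ∀ u v → key u ≡ key v → u ≡ v
  key-injective u v ku≡kv with <-cmp (σ G γ u) (σ G γ v)
  ... | tri< σu<σv _ _ = ⊥-elim (<⇒≢ (key-strict u v σu<σv) ku≡kv)
  ... | tri> _ _ σv<σu = ⊥-elim (<⇒≢ (key-strict v u σv<σu) (sym ku≡kv))
  ... | tri≈ _ σu≡σv _ = toℕ-injective (+-cancelˡ-≡ (σ G γ u * n) _ _
                           (trans ku≡kv (cong (λ x → x * n + toℕ v) (sym σu≡σv))))

  open Ranking key key-injective
  open Blocks rank rank<n rank-prefix
  open Filling (countE G γ) γ-equitable

  vertex-classes : Vec ℕ (suc k₀)
  vertex-classes = proj₁ (fill n)

  γv : Fin n → Fin (suc k₀)
  γv v = block 0 vertex-classes (rank v)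

  -- the colour classes of γv are the block sizes (ranks start at 0)
  countV-γv : ∀ c → countV G γv c ≡ lookup vertex-classes c
  countV-γv c = trans (length-filter-tabulate (λ v → γv v ≟ c) n (λ v → v))
                      (block-count vertex-classes 0 (proj₁ (proj₂ (fill n))) c)

  -- vertex plus edge class sizes are the filled totals, equitable by fill
  equitable : EquitableTotal G γv γ
  equitable c c' rewrite countV-γv c | countV-γv c' =
    subst₂ (λ x y → x ≤ suc y) (+-comm (countE G γ c) _) (+-comm (countE G γ c') _)
           (proj₂ (proj₂ (fill n)) c c')

  -- the vertex colouring is monotone in σ, so it preserves strict inequalities
  σT-strict : ∀ u v → σ G γ u < σ G γ v → σT G γv γ u < σT G γv γ v
  σT-strict u v σu<σv =
    +-mono-≤-< (s≤s (block-mono 0 vertex-classes (rank-mono u v (<⇒≤ (key-strict u v σu<σv))))) σu<σv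

  nsd : NSDTotal G γv γ
  nsd e with <-cmp (σ G γ (proj₁ (ends e))) (σ G γ (proj₂ (ends e)))
  ... | tri< σu<σv _ _ = <⇒≢ (σT-strict _ _ σu<σv)
  ... | tri≈ _ σu≡σv _ = ⊥-elim (γ-nsd e σu≡σv)
  ... | tri> _ _ σv<σu = ≢-sym (<⇒≢ (σT-strict _ _ σv<σu))

proposition1 : (G : Graph) → NoIsolatedEdges G →
    (k : ℕ) → 1 ≤ k → HasEqNSDEdge G k →
    Σ ℕ (λ k' → 1 ≤ k' × k' ≤ k × HasEqNSDTotal G k')
proposition1 G _ (suc k₀) _ (γ , γ-equitable , γ-nsd) =
  suc k₀ , s≤s z≤n , ≤-refl , γv , γ , equitable , nsd
  where open FromEdgeColouring G γ γ-equitable γ-nsd
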